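{- Let $\{n_0,\dots,n_0+7\}\subset\{1,\dots,N\}$ and let $\alpha\colon\mathbb{Z}\to\mathbb{Z}/q\mathbb{Z}$ be an affine function (i.e. $\alpha(n)=sn+c$ for some $s,c\in\mathbb{Z}/q\mathbb{Z}$). Suppose $g\colon\{1,\dots,N\}\to\Sigma$ is given by $g(n)=f_q(an+b)$ for some integers $a,b$, and that $g(n)=\alpha(n)$ for every $n\in\{n_0,\dots,n_0+7\}$ with $\alpha(n)\neq0$. Then $g(n)=\alpha(n)$ for every $n\in\{1,\dots,N\}$ with $\alpha(n)\neq0$.
   Context: Throughout, $q=2^{s_0}$ is a fixed, sufficiently large power of two, $N=q^2$, and $\Sigma=(\mathbb{Z}/q\mathbb{Z})\setminus\{0\}$. The function $f_q\colon\mathbb{Z}\to\Sigma$ is defined by $f_q(q^km)=m\bmod q$ for $k\ge0$ and $m$ not divisible by $q$, and $f_q(0)=1$. -}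

module Defs where

open import Data.Nat as ℕ using (ℕ; zero; suc; NonZero; _^_)
open import Data.Integer using (ℤ; +_; ∣_∣; _/ℕ_; _%ℕ_)
open import Data.Integer.Properties using (_≟_)
open import Relation.Nullary using (yes; no)
open import Data.Unit using (tt)

-- On input x it strips factors
-- of q (x ↦ x / q while q ∣ x, x ≠ 0) and returns the residue of the
-- remaining q-free part m modulo q, as a natural number in [0, q).
-- Since q ≥ 2 in all uses, suc ∣ x ∣ steps of fuel always suffice.
fqFuel : ℕ → (q : ℕ) .{{_ : NonZero q}} → ℤ → ℕ
fqFuel zero      q x = 1
fqFuel (suc k) q x with x ≟ + 0
... | yes _ = 1
... | no  _ with x %ℕ q
...   | zero  = fqFuel k q (x /ℕ q)
...   | suc r = suc r

-- f_q(q^k m) = m mod q  (q ∤ m),  f_q(0) = 1.  Values of Z/qZ are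
-- represented by their canonical residues in {0,…,q-1}.
fq : (q : ℕ) .{{_ : NonZero q}} → ℤ → ℕ
fq q x = fqFuel (suc ∣ x ∣) q x

affine : (q : ℕ) .{{_ : NonZero q}} → ℕ → ℕ → ℕ → ℕ
affine q s c n = (s ℕ.* n ℕ.+ c) ℕ.% q

pow2-nonzero : ∀ k → NonZero (2 ^ k)
pow2-nonzero k = Data.Nat.Properties.m^n≢0 2 k ⦃ record { nonZero = tt } ⦄
  where import Data.Nat.Properties

f : (s₀ : ℕ) → ℤ → ℕ
f s₀ = fq (2 ^ s₀) ⦃ pow2-nonzero s₀ ⦄

α : (s₀ : ℕ) → ℕ → ℕ → ℕ → ℕ
α s₀ = affine (2 ^ s₀) ⦃ pow2-nonzero s₀ ⦄

module Submission where

-- Write g(x) = f_q(ax + b), α(x) = sx + c and D(x) = (a - s)x + (b - c).  Where q ∤ ax + b,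
-- f_q(ax + b) is the residue of ax + b, so there agreement means q ∣ D(x).  Dividing a and b
-- by q does not change g, so we may assume that q does not divide both.  The heart of the proof
-- is that no point x of the window has q ∣ ax + b but q ∤ α(x): at the four points after it (or
-- before it, near the end of the window) agreement forces q ∣ α or q ∣ D, and the three affine
-- maps cannot meet all these conditions once one uses that, for q ∣ y, f_q(y) is even only when
-- 2q ∣ y (here 8 ∣ q and 3 ∤ q).  Hence q ∣ D wherever q ∤ α in the window, and since α and D
-- are affine this propagates from five consecutive points to all of ℤ.

module AffineAgreement where

  open import Data.Empty using (⊥; ⊥-elim)
  open import Data.Integer
    using (ℤ; +_; ∣_∣; _/ℕ_; _%ℕ_; _+_; _*_; -_; _-_; _⊖_)
  open import Data.Integer.DivMod using (a≡a%ℕn+[a/ℕn]*n; n%ℕd<d)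
  open import Data.Integer.Divisibility.Signed
  import Data.Integer.Properties as ℤ
  open import Data.Integer.Tactic.RingSolver using (solve-∀; solve)
  open import Data.List using (_∷_; [])
  open import Data.Nat as ℕ using (ℕ; zero; suc; NonZero; _^_)
  open import Data.Nat.Coprimality using (Coprime; coprime-divisor; 1-coprimeTo)
  import Data.Nat.Divisibility as ℕ
  import Data.Nat.DivMod as ℕ
  open import Data.Nat.Induction using (<-wellFounded)
  import Data.Nat.Properties as ℕ
  open import Data.Product using (_×_; _,_; ∃₂)
  open import Data.Sum using (_⊎_; inj₁; inj₂; [_,_]′)
  open import Defs
  open import Induction.WellFounded using (Acc; acc)
  open import Relation.Binary.PropositionalEquality
  open import Relation.Nullary using (¬_; Dec; yes; no)
  open import Relation.Nullary.Decidable using (True; toWitness; toSum; _×-dec_)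

  infixl 4 _⟫_
  _⟫_ : ∀ {m x y} → m ∣ x → x ≡ y → m ∣ y
  m∣x ⟫ refl = m∣x

  ∣m∣m-n⇒∣n : ∀ {k m n} → k ∣ m → k ∣ m - n → k ∣ n
  ∣m∣m-n⇒∣n {m = m} {n} k∣m k∣m-n = ∣m∣n⇒∣m-n k∣m k∣m-n ⟫ solve (m ∷ n ∷ [])

  -- Divisibility along affine maps x ↦ a * x + b

  affine-step : ∀ a b x y → a * (x + y) + b ≡ (a * x + b) + y * a
  affine-step = solve-∀

  affine-shift : ∀ a b x y → a * (x + y) + b ≡ a * y + (a * x + b)
  affine-shift = solve-∀

  affine-reflect : ∀ a b x y → a * (x - y) + b ≡ (- a) * y + (a * x + b)
  affine-reflect = solve-∀

  affine-sub : ∀ a b s c x → (a * x + b) - (s * x + c) ≡ (a - s) * x + (b - c)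
  affine-sub = solve-∀

  module _ {m : ℤ} (a b : ℤ) where

    ∣-affine-forward : ∀ x y → m ∣ a * x + b → m ∣ y * a → m ∣ a * (x + y) + b
    ∣-affine-forward x y m∣fx m∣ya = ∣m∣n⇒∣m+n m∣fx m∣ya ⟫ sym (affine-step a b x y)

    ∣-affine-backward : ∀ x y → m ∣ a * (x + y) + b → m ∣ y * a → m ∣ a * x + b
    ∣-affine-backward x y m∣fx+y m∣ya = ∣m+n∣n⇒∣m (m∣fx+y ⟫ affine-step a b x y) m∣ya

    ∣-affine-difference : ∀ x y → m ∣ a * x + b → m ∣ a * (x + y) + b → m ∣ y * a
    ∣-affine-difference x y m∣fx m∣fx+y = ∣m+n∣m⇒∣n (m∣fx+y ⟫ affine-step a b x y) m∣fx

    ∣-affine-progression : ∀ x y → m ∣ a * x + b → m ∣ a * (x + y) + b →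
                           ∀ u → m ∣ a * (x + u * y) + b
    ∣-affine-progression x y m∣fx m∣fx+y u = ∣-affine-forward x (u * y) m∣fx
      (∣n⇒∣m*n u (∣-affine-difference x y m∣fx m∣fx+y) ⟫ sym (ℤ.*-assoc u y a))

    ∣-affine-consecutive : ∀ x → m ∣ a * x + b → m ∣ a * (x + + 1) + b →
                           ∀ n → m ∣ a * n + b
    ∣-affine-consecutive x m∣fx m∣fx+1 n =
      ∣-affine-progression x (+ 1) m∣fx m∣fx+1 (n - x) ⟫ cong (λ z → a * z + b) x+[n-x]*1≡n
      where
      x+[n-x]*1≡n : x + (n - x) * + 1 ≡ n
      x+[n-x]*1≡n = solve (x ∷ n ∷ [])

  ∣-affine-doubled : ∀ {m} a b x → m ∣ a * x + b → m ∣ a * (x + + 2) + b →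
                     ∀ n → m ∣ + 2 * (a * n + b)
  ∣-affine-doubled a b x m∣fx m∣fx+2 n =
    ∣-affine-consecutive (+ 2 * a) (+ 2 * b) x
      (∣n⇒∣m*n (+ 2) m∣fx ⟫ solve (a ∷ b ∷ x ∷ []))
      (∣m∣n⇒∣m+n m∣fx m∣fx+2 ⟫ solve (a ∷ b ∷ x ∷ []))
      n
    ⟫ solve (a ∷ b ∷ n ∷ [])

  ∣-affine-alternating : ∀ {m} a b s c x →
    m ∣ s * x + c → m ∣ s * (x + + 2) + c → m ∣ a * (x + + 1) + b → m ∣ a * (x + + 3) + b →
    ∀ n → ¬ m ∣ s * n + c → m ∣ a * n + b
  ∣-affine-alternating {m} a b s c x m∣gx m∣gx+2 m∣fx+1 m∣fx+3 n m∤gn =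
    by-parity ((n - x) %ℕ 2) (n%ℕd<d (n - x) 2)
      (trans n≡x+[n-x] (cong (λ z → x + z) (a≡a%ℕn+[a/ℕn]*n (n - x) 2)))
    where
    n≡x+[n-x] : n ≡ x + (n - x)
    n≡x+[n-x] = solve (n ∷ x ∷ [])
    u = (n - x) /ℕ 2
    by-parity : ∀ r → r ℕ.< 2 → n ≡ x + (+ r + u * + 2) → m ∣ a * n + b
    by-parity 0 _ n≡x+2u = ⊥-elim (m∤gn (∣-affine-progression s c x (+ 2) m∣gx m∣gx+2 u
      ⟫ cong (λ z → s * z + c) (trans (cong (λ z → x + z) (sym (ℤ.+-identityˡ (u * + 2))))
                                      (sym n≡x+2u))))
    by-parity 1 _ n≡x+1+2u = ∣-affine-progression a b (x + + 1) (+ 2) m∣fx+1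
        (m∣fx+3 ⟫ cong (λ z → a * z + b) (sym (ℤ.+-assoc x (+ 1) (+ 2)))) u
      ⟫ cong (λ z → a * z + b) (trans (ℤ.+-assoc x (+ 1) (u * + 2)) (sym n≡x+1+2u))
    by-parity (suc (suc _)) (ℕ.s≤s (ℕ.s≤s ())) _

  ∣-affine-interleaved : ∀ {m} a b s c → m ∣ b + c →
    m ∣ a * + 1 + b → m ∣ s * + 2 + c → m ∣ a * + 3 + b →
    (m ∣ + 2 * b) × (m ∣ + 2 * c) × (m ∣ + 4 * a) × (m ∣ + 4 * s)
  ∣-affine-interleaved {m} a b s c m∣b+c m∣f₁ m∣g₂ m∣f₃ = m∣2b , m∣2c , m∣4a , m∣4s
    where
    m∣2f : ∀ n → m ∣ + 2 * (a * n + b)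
    m∣2f = ∣-affine-doubled a b (+ 1) m∣f₁ m∣f₃
    m∣2b : m ∣ + 2 * b
    m∣2b = m∣2f (+ 0) ⟫ solve (a ∷ b ∷ [])
    m∣2c : m ∣ + 2 * c
    m∣2c = ∣m∣n⇒∣m-n (∣n⇒∣m*n (+ 2) m∣b+c) m∣2b ⟫ solve (b ∷ c ∷ [])
    m∣4a : m ∣ + 4 * a
    m∣4a = ∣n⇒∣m*n (+ 2) (∣-affine-difference a b (+ 1) (+ 2) m∣f₁ m∣f₃) ⟫ solve (a ∷ [])
    m∣2f₂+2g₂ : m ∣ + 2 * (a * + 2 + b) + + 2 * (s * + 2 + c)
    m∣2f₂+2g₂ = ∣m∣n⇒∣m+n (m∣2f (+ 2)) (∣n⇒∣m*n (+ 2) m∣g₂)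
    m∣4s : m ∣ + 4 * s
    m∣4s = ∣m∣n⇒∣m-n (∣m∣n⇒∣m-n m∣2f₂+2g₂ (∣n⇒∣m*n (+ 2) m∣b+c)) m∣4a
      ⟫ solve (a ∷ b ∷ s ∷ c ∷ [])

  module _ {m : ℤ} (a b s c : ℤ)
           (window : ∀ j → j ℕ.≤ 4 → ¬ m ∣ s * + j + c → m ∣ a * + j + b) where

    private
      window′ : ∀ j {j≤4 : True (j ℕ.≤? 4)} → ¬ m ∣ s * + j + c → m ∣ a * + j + b
      window′ j {j≤4} = window j (toWitness j≤4)

    -- Two consecutive zeros of s * x + c make it vanish everywhere, two consecutive non-zeros
    -- make a * x + b vanish everywhere, and otherwise s * x + c alternates.
    affine-propagation : ∀ n → ¬ m ∣ s * n + c → m ∣ a * n + b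
    affine-propagation n m∤gn
      with m ∣? s * + 0 + c | m ∣? s * + 1 + c | m ∣? s * + 2 + c | m ∣? s * + 3 + c
         | m ∣? s * + 4 + c
    ... | no m∤g₀  | no m∤g₁  | _        | _        | _        =
      ∣-affine-consecutive a b (+ 0) (window′ 0 m∤g₀) (window′ 1 m∤g₁) n
    ... | _        | no m∤g₁  | no m∤g₂  | _        | _        =
      ∣-affine-consecutive a b (+ 1) (window′ 1 m∤g₁) (window′ 2 m∤g₂) n
    ... | _        | _        | no m∤g₂  | no m∤g₃  | _        =
      ∣-affine-consecutive a b (+ 2) (window′ 2 m∤g₂) (window′ 3 m∤g₃) n
    ... | _        | _        | _        | no m∤g₃  | no m∤g₄  =
      ∣-affine-consecutive a b (+ 3) (window′ 3 m∤g₃) (window′ 4 m∤g₄) n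
    ... | yes m∣g₀ | yes m∣g₁ | _        | _        | _        =
      ⊥-elim (m∤gn (∣-affine-consecutive s c (+ 0) m∣g₀ m∣g₁ n))
    ... | _        | yes m∣g₁ | yes m∣g₂ | _        | _        =
      ⊥-elim (m∤gn (∣-affine-consecutive s c (+ 1) m∣g₁ m∣g₂ n))
    ... | _        | _        | yes m∣g₂ | yes m∣g₃ | _        =
      ⊥-elim (m∤gn (∣-affine-consecutive s c (+ 2) m∣g₂ m∣g₃ n))
    ... | _        | _        | _        | yes m∣g₃ | yes m∣g₄ =
      ⊥-elim (m∤gn (∣-affine-consecutive s c (+ 3) m∣g₃ m∣g₄ n))
    ... | yes m∣g₀ | no m∤g₁  | yes m∣g₂ | no m∤g₃  | _        =
      ∣-affine-alternating a b s c (+ 0) m∣g₀ m∣g₂ (window′ 1 m∤g₁) (window′ 3 m∤g₃) n m∤gn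
    ... | no m∤g₀  | yes m∣g₁ | no m∤g₂  | yes m∣g₃ | no m∤g₄  =
      ∣-affine-alternating a b s c (+ 1) m∣g₁ m∣g₃ (window′ 2 m∤g₂) (window′ 4 m∤g₄) n m∤gn

  -- Residues modulo q and the function f_q

  record Agrees (q : ℕ) .⦃ _ : NonZero q ⦄ (a b s c x : ℤ) : Set where
    constructor agreeing
    field
      agree : ¬ + q ∣ s * x + c → fq q (a * x + b) ≡ (s * x + c) %ℕ q

  open Agrees

  module _ {q : ℕ} ⦃ _ : NonZero q ⦄ where

    x-y≡Δr+Δk*q : ∀ x y → x - y ≡ (+ (x %ℕ q) - + (y %ℕ q)) + (x /ℕ q - y /ℕ q) * + q
    x-y≡Δr+Δk*q x y = begin
      x - y
        ≡⟨ cong₂ _-_ (a≡a%ℕn+[a/ℕn]*n x q) (a≡a%ℕn+[a/ℕn]*n y q) ⟩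
      (+ (x %ℕ q) + x /ℕ q * + q) - (+ (y %ℕ q) + y /ℕ q * + q)
        ≡⟨ regroup (+ (x %ℕ q)) (+ (y %ℕ q)) (x /ℕ q) (y /ℕ q) (+ q) ⟩
      (+ (x %ℕ q) - + (y %ℕ q)) + (x /ℕ q - y /ℕ q) * + q ∎
      where
      open ≡-Reasoning
      regroup : ∀ r r′ k k′ Q → (r + k * Q) - (r′ + k′ * Q) ≡ (r - r′) + (k - k′) * Q
      regroup = solve-∀

    ∣r₁-r₂⇒r₁≡r₂ : ∀ {r₁ r₂} → r₁ ℕ.< q → r₂ ℕ.< q → + q ∣ + r₁ - + r₂ → r₁ ≡ r₂
    ∣r₁-r₂⇒r₁≡r₂ {r₁} {r₂} r₁<q r₂<q q∣r₁-r₂ =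
      ℤ.+-injective (ℤ.i-j≡0⇒i≡j (+ r₁) (+ r₂) (ℤ.∣i∣≡0⇒i≡0 ∣r₁-r₂∣≡0))
      where
      ∣r₁-r₂∣<q : ∣ + r₁ - + r₂ ∣ ℕ.< q
      ∣r₁-r₂∣<q = begin-strict
        ∣ + r₁ - + r₂ ∣ ≡⟨ cong ∣_∣ (ℤ.m-n≡m⊖n r₁ r₂) ⟩
        ∣ r₁ ⊖ r₂ ∣     ≤⟨ ℤ.∣m⊝n∣≤m⊔n r₁ r₂ ⟩
        r₁ ℕ.⊔ r₂       <⟨ ℕ.⊔-lub r₁<q r₂<q ⟩
        q               ∎
        where open ℕ.≤-Reasoning
      ∣r₁-r₂∣≡0 : ∣ + r₁ - + r₂ ∣ ≡ 0
      ∣r₁-r₂∣≡0 = trans (sym (ℕ.m<n⇒m%n≡m ∣r₁-r₂∣<q)) (ℕ.n∣m⇒m%n≡0 _ q (∣⇒∣ᵤ q∣r₁-r₂))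

    ∣⇒%ℕ-≡ : ∀ x y → + q ∣ x - y → x %ℕ q ≡ y %ℕ q
    ∣⇒%ℕ-≡ x y q∣x-y = ∣r₁-r₂⇒r₁≡r₂ (n%ℕd<d x q) (n%ℕd<d y q)
      (∣m+n∣n⇒∣m (q∣x-y ⟫ x-y≡Δr+Δk*q x y) (divides (x /ℕ q - y /ℕ q) refl))

    %ℕ-≡⇒∣ : ∀ x y → x %ℕ q ≡ y %ℕ q → + q ∣ x - y
    %ℕ-≡⇒∣ x y rx≡ry = divides (x /ℕ q - y /ℕ q) (begin
      x - y                                                 ≡⟨ x-y≡Δr+Δk*q x y ⟩
      (+ (x %ℕ q) - + (y %ℕ q)) + (x /ℕ q - y /ℕ q) * + q   ≡⟨ cong (_+ (x /ℕ q - y /ℕ q) * + q)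
                                                                 (ℤ.i≡j⇒i-j≡0 (cong +_ rx≡ry)) ⟩
      + 0 + (x /ℕ q - y /ℕ q) * + q                         ≡⟨ ℤ.+-identityˡ _ ⟩
      (x /ℕ q - y /ℕ q) * + q                               ∎)
      where open ≡-Reasoning

    ∣⇒%ℕ≡0 : ∀ x → + q ∣ x → x %ℕ q ≡ 0
    ∣⇒%ℕ≡0 x q∣x = trans (∣⇒%ℕ-≡ x (+ 0) (q∣x ⟫ sym (ℤ.+-identityʳ x))) (ℕ.m*n%n≡0 0 q)

    %ℕ≡0⇒∣ : ∀ x → x %ℕ q ≡ 0 → + q ∣ x
    %ℕ≡0⇒∣ x rx≡0 = %ℕ-≡⇒∣ x (+ 0) (trans rx≡0 (sym (ℕ.m*n%n≡0 0 q))) ⟫ ℤ.+-identityʳ x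

    %ℕ≡0⇒exact : ∀ x → x %ℕ q ≡ 0 → x ≡ x /ℕ q * + q
    %ℕ≡0⇒exact x rx≡0 = begin
      x                          ≡⟨ a≡a%ℕn+[a/ℕn]*n x q ⟩
      + (x %ℕ q) + x /ℕ q * + q  ≡⟨ cong (λ r → + r + x /ℕ q * + q) rx≡0 ⟩
      + 0 + x /ℕ q * + q         ≡⟨ ℤ.+-identityˡ _ ⟩
      x /ℕ q * + q               ∎
      where open ≡-Reasoning

    2∣⇒2∣%ℕ : 2 ℕ.∣ q → ∀ x → + 2 ∣ x → + 2 ∣ + (x %ℕ q)
    2∣⇒2∣%ℕ 2∣q x 2∣x = ∣m∣n⇒∣m-n 2∣x (∣n⇒∣m*n (x /ℕ q) (∣ᵤ⇒∣ 2∣q))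
      ⟫ trans (cong (_- x /ℕ q * + q) (a≡a%ℕn+[a/ℕn]*n x q)) (r+k-k≡r (+ (x %ℕ q)) (x /ℕ q * + q))
      where
      r+k-k≡r : ∀ r k → r + k - k ≡ r
      r+k-k≡r = solve-∀

    fqFuel-∤ : ∀ k x → ¬ + q ∣ x → fqFuel (suc k) q x ≡ x %ℕ q
    fqFuel-∤ k x q∤x with x ℤ.≟ + 0
    ... | yes refl = ⊥-elim (q∤x (divides (+ 0) refl))
    ... | no _ with x %ℕ q in rx≡
    ...   | zero  = ⊥-elim (q∤x (%ℕ≡0⇒∣ x rx≡))
    ...   | suc _ = refl

    fq-∤ : ∀ x → ¬ + q ∣ x → fq q x ≡ x %ℕ q
    fq-∤ x = fqFuel-∤ ∣ x ∣ x

    fqFuel-even : 2 ℕ.∣ q → ∀ k x → + 2 ∣ + fqFuel k q x → + 2 ∣ x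
    fqFuel-even 2∣q zero x 2∣1 with () ← ℕ.∣1⇒≡1 (∣⇒∣ᵤ 2∣1)
    fqFuel-even 2∣q (suc k) x 2∣fx with x ℤ.≟ + 0
    ... | yes refl = divides (+ 0) refl
    ... | no _ with x %ℕ q in rx≡
    ...   | zero  = ∣m⇒∣m*n (+ q) (fqFuel-even 2∣q k (x /ℕ q) 2∣fx) ⟫ sym (%ℕ≡0⇒exact x rx≡)
    ...   | suc _ = ∣m∣n⇒∣m+n 2∣fx (∣n⇒∣m*n (x /ℕ q) (∣ᵤ⇒∣ 2∣q))
                      ⟫ sym (trans (a≡a%ℕn+[a/ℕn]*n x q) (cong (λ r → + r + x /ℕ q * + q) rx≡))

    ReducedForm : ℤ → ℤ → Set
    ReducedForm a b = ∃₂ λ a′ b′ → ¬ ((+ q ∣ a′) × (+ q ∣ b′)) ×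
                                   (∀ x → fq q (a * x + b) ≡ fq q (a′ * x + b′))

    Agrees-cong : ∀ {a b s c x a′ b′ s′ c′ x′} →
                  fq q (a * x + b) ≡ fq q (a′ * x′ + b′) → s * x + c ≡ s′ * x′ + c′ →
                  Agrees q a b s c x → Agrees q a′ b′ s′ c′ x′
    Agrees-cong g≡g′ α≡α′ agreeₓ = agreeing λ q∤α′ →
      trans (sym g≡g′) (trans (agree agreeₓ (λ q∣α → q∤α′ (q∣α ⟫ α≡α′))) (cong (_%ℕ q) α≡α′))

    module _ (1<q : 1 ℕ.< q) where

      ∣x∣<∣x*q∣ : ∀ x → x ≢ + 0 → ∣ x ∣ ℕ.< ∣ x * + q ∣
      ∣x∣<∣x*q∣ x x≢0 = subst (∣ x ∣ ℕ.<_) (sym (ℤ.abs-* x (+ q)))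
        (ℕ.m<m*n ∣ x ∣ q ⦃ ℕ.≢-nonZero (λ ∣x∣≡0 → x≢0 (ℤ.∣i∣≡0⇒i≡0 ∣x∣≡0)) ⦄ 1<q)

      ∣x/q∣<∣x∣ : ∀ x → x ≢ + 0 → x %ℕ q ≡ 0 → ∣ x /ℕ q ∣ ℕ.< ∣ x ∣
      ∣x/q∣<∣x∣ x x≢0 rx≡0 = subst (λ z → ∣ x /ℕ q ∣ ℕ.< ∣ z ∣) (sym x≡x/q*q)
        (∣x∣<∣x*q∣ (x /ℕ q) (λ x/q≡0 → x≢0 (trans x≡x/q*q (cong (_* + q) x/q≡0))))
        where x≡x/q*q = %ℕ≡0⇒exact x rx≡0

      fqFuel-stable : ∀ k k′ x → ∣ x ∣ ℕ.< k → ∣ x ∣ ℕ.< k′ → fqFuel k q x ≡ fqFuel k′ q x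
      fqFuel-stable (suc k) (suc k′) x x<k x<k′ with x ℤ.≟ + 0
      ... | yes _ = refl
      ... | no x≢0 with x %ℕ q in rx≡
      ...   | zero  = fqFuel-stable k k′ (x /ℕ q)
                        (ℕ.<-≤-trans (∣x/q∣<∣x∣ x x≢0 rx≡) (ℕ.≤-pred x<k))
                        (ℕ.<-≤-trans (∣x/q∣<∣x∣ x x≢0 rx≡) (ℕ.≤-pred x<k′))
      ...   | suc _ = refl

      fqFuel-*q : ∀ k y → y ≢ + 0 → fqFuel (suc k) q (y * + q) ≡ fqFuel k q y
      fqFuel-*q k y y≢0 with y * + q ℤ.≟ + 0
      ... | yes yq≡0 = ⊥-elim (y≢0 (ℤ.*-cancelʳ-≡ y (+ 0) (+ q) yq≡0))
      ... | no _ with (y * + q) %ℕ q in r≡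
      ...   | zero  = cong (fqFuel k q)
                        (ℤ.*-cancelʳ-≡ _ y (+ q) (sym (%ℕ≡0⇒exact (y * + q) r≡)))
      ...   | suc _ = ⊥-elim (ℕ.1+n≢0 (trans (sym r≡) (∣⇒%ℕ≡0 (y * + q) (divides y refl))))

      fq-*q : ∀ y → fq q (y * + q) ≡ fq q y
      fq-*q y = by-cases (y ℤ.≟ + 0)
        where
        by-cases : Dec (y ≡ + 0) → fq q (y * + q) ≡ fq q y
        by-cases (yes y≡0) = subst (λ z → fq q (z * + q) ≡ fq q z) (sym y≡0) refl
        by-cases (no y≢0)  = trans (fqFuel-*q ∣ y * + q ∣ y y≢0)
          (fqFuel-stable ∣ y * + q ∣ (suc ∣ y ∣) y (∣x∣<∣x*q∣ y y≢0) ℕ.≤-refl)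

      fq-even⇒2q∣ : 2 ℕ.∣ q → ∀ x → + q ∣ x → + 2 ∣ + fq q x → + 2 * + q ∣ x
      fq-even⇒2q∣ 2∣q x q∣x 2∣fx = *-monoˡ-∣ (+ q) 2∣x/q ⟫ sym x≡x/q*q
        where
        x≡x/q*q = %ℕ≡0⇒exact x (∣⇒%ℕ≡0 x q∣x)
        2∣x/q : + 2 ∣ x /ℕ q
        2∣x/q = fqFuel-even 2∣q (suc ∣ x /ℕ q ∣) (x /ℕ q)
          (subst (λ z → + 2 ∣ + z) (trans (cong (fq q) x≡x/q*q) (fq-*q (x /ℕ q))) 2∣fx)

      q∤1 : ¬ + q ∣ + 1
      q∤1 q∣1 = ℕ.<⇒≢ 1<q (sym (ℕ.∣1⇒≡1 (∣⇒∣ᵤ q∣1)))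

      fq-1 : fq q (+ 1) ≡ 1
      fq-1 = trans (fq-∤ (+ 1) q∤1) (ℕ.m<n⇒m%n≡m 1<q)

      ∣x∣+∣y∣<∣xq∣+∣yq∣ : ∀ x y → ¬ (x ≡ + 0 × y ≡ + 0) →
                          ∣ x ∣ ℕ.+ ∣ y ∣ ℕ.< ∣ x * + q ∣ ℕ.+ ∣ y * + q ∣
      ∣x∣+∣y∣<∣xq∣+∣yq∣ x y not-both-0 = subst (∣ x ∣ ℕ.+ ∣ y ∣ ℕ.<_) ∣xq∣+∣yq∣≡
        (ℕ.m<m*n (∣ x ∣ ℕ.+ ∣ y ∣) q ⦃ ℕ.≢-nonZero ∣x∣+∣y∣≢0 ⦄ 1<q)
        where
        ∣xq∣+∣yq∣≡ : (∣ x ∣ ℕ.+ ∣ y ∣) ℕ.* q ≡ ∣ x * + q ∣ ℕ.+ ∣ y * + q ∣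
        ∣xq∣+∣yq∣≡ = trans (ℕ.*-distribʳ-+ q ∣ x ∣ ∣ y ∣)
                          (sym (cong₂ ℕ._+_ (ℤ.abs-* x (+ q)) (ℤ.abs-* y (+ q))))
        ∣x∣+∣y∣≢0 : ∣ x ∣ ℕ.+ ∣ y ∣ ≢ 0
        ∣x∣+∣y∣≢0 sum≡0 = not-both-0 (ℤ.∣i∣≡0⇒i≡0 (ℕ.m+n≡0⇒m≡0 ∣ x ∣ sum≡0) ,
                                     ℤ.∣i∣≡0⇒i≡0 (ℕ.m+n≡0⇒n≡0 ∣ x ∣ sum≡0))

      reduced-form : ∀ a b → ReducedForm a b
      reduced-form a b = go a b (<-wellFounded (∣ a ∣ ℕ.+ ∣ b ∣))
        where
        factor-q : ∀ a b Q x → a * Q * x + b * Q ≡ (a * x + b) * Q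
        factor-q = solve-∀
        go : ∀ a b → Acc ℕ._<_ (∣ a ∣ ℕ.+ ∣ b ∣) → ReducedForm a b
        go a b _ with + q ∣? a | + q ∣? b
        go a b _ | no q∤a | _ = a , b , (λ (q∣a , _) → q∤a q∣a) , λ _ → refl
        go a b _ | yes _ | no q∤b = a , b , (λ (_ , q∣b) → q∤b q∣b) , λ _ → refl
        go _ _ (acc rec) | yes (divides a₁ refl) | yes (divides b₁ refl)
          with a₁ ℤ.≟ + 0 ×-dec b₁ ℤ.≟ + 0
        ... | yes (refl , refl) = + 0 , + 1 , (λ (_ , q∣1) → q∤1 q∣1) , λ _ → sym fq-1
        ... | no not-both-0 =
          let a′ , b′ , reduced , g≡g′ = go a₁ b₁ (rec (∣x∣+∣y∣<∣xq∣+∣yq∣ a₁ b₁ not-both-0))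
          in a′ , b′ , reduced , λ x → trans (cong (fq q) (factor-q a₁ b₁ (+ q) x))
                                             (trans (fq-*q (a₁ * x + b₁)) (g≡g′ x))

  -- No isolated zero of a * x + b in a window

  module _ {q : ℕ} ⦃ _ : NonZero q ⦄ (8∣q : 8 ℕ.∣ q) (q⊥3 : Coprime q 3) where

    private
      2∣q : 2 ℕ.∣ q
      2∣q = ℕ.∣-trans (ℕ.divides 4 refl) 8∣q

      1<q : 1 ℕ.< q
      1<q = ℕ.<-≤-trans (ℕ.s≤s (ℕ.s≤s ℕ.z≤n)) (ℕ.∣⇒≤ 8∣q)

      ∣4x⇒2∣x : ∀ x → + q ∣ + 4 * x → + 2 ∣ x
      ∣4x⇒2∣x x q∣4x = *-cancelˡ-∣ (+ 4) {+ 2} (∣-trans (∣ᵤ⇒∣ 8∣q) q∣4x)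

      ∣2x⇒2∣x : ∀ x → + q ∣ + 2 * x → + 2 ∣ x
      ∣2x⇒2∣x x q∣2x = ∣4x⇒2∣x x (∣n⇒∣m*n (+ 2) q∣2x ⟫ sym (ℤ.*-assoc (+ 2) (+ 2) x))

      ∣3x⇒∣x : ∀ x → + q ∣ + 3 * x → + q ∣ x
      ∣3x⇒∣x x q∣3x =
        ∣ᵤ⇒∣ (coprime-divisor q⊥3 (subst (q ℕ.∣_) (ℤ.abs-* (+ 3) x) (∣⇒∣ᵤ q∣3x)))

      -- U, P and D stand for a * x + b, s * x + c and (a - s) * x + (b - c).
      module IsolatedZero (a b s c : ℤ) (q∣b : + q ∣ b) (q∤c : ¬ + q ∣ c) (q∤a : ¬ + q ∣ a)
                          (window : ∀ j → j ℕ.≤ 4 → Agrees q a b s c (+ j)) where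

        window′ : ∀ j {j≤4 : True (j ℕ.≤? 4)} → Agrees q a b s c (+ j)
        window′ j {j≤4} = window j (toWitness j≤4)

        q∣U₀ : + q ∣ a * + 0 + b
        q∣U₀ = q∣b ⟫ solve (a ∷ b ∷ [])

        q∤P₀ : ¬ + q ∣ s * + 0 + c
        q∤P₀ q∣P₀ = q∤c (q∣P₀ ⟫ solve (s ∷ c ∷ []))

        q∤D₀ : ¬ + q ∣ (a - s) * + 0 + (b - c)
        q∤D₀ q∣D₀ = q∤c (∣m∣m-n⇒∣n q∣b (q∣D₀ ⟫ solve (a ∷ b ∷ s ∷ c ∷ [])))

        q∤U₁ : ¬ + q ∣ a * + 1 + b
        q∤U₁ q∣U₁ = q∤a (∣-affine-difference a b (+ 0) (+ 1) q∣U₀ q∣U₁ ⟫ ℤ.*-identityˡ a)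

        P∣∨D∣ : ℤ → Set
        P∣∨D∣ x = (+ q ∣ s * x + c) ⊎ (+ q ∣ (a - s) * x + (b - c))

        P-or-D : ∀ x → Agrees q a b s c x → ¬ + q ∣ a * x + b → P∣∨D∣ x
        P-or-D x agreeₓ q∤U with + q ∣? s * x + c
        ... | yes q∣P = inj₁ q∣P
        ... | no q∤P = inj₂
          (%ℕ-≡⇒∣ (a * x + b) (s * x + c) (trans (sym (fq-∤ _ q∤U)) (agree agreeₓ q∤P))
           ⟫ affine-sub a b s c x)

        2q∣U : ∀ x → Agrees q a b s c x → + q ∣ a * x + b → ¬ + q ∣ s * x + c →
               + 2 ∣ s * x + c → + 2 * + q ∣ a * x + b
        2q∣U x agreeₓ q∣U q∤P 2∣P = fq-even⇒2q∣ 1<q 2∣q _ q∣U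
          (subst (λ r → + 2 ∣ + r) (sym (agree agreeₓ q∤P)) (2∣⇒2∣%ℕ 2∣q _ 2∣P))

        -- If q ∣ 2a then U vanishes at 0 and 2, so 2U vanishes everywhere and q ∣ 2P at 1 and 3;
        -- hence P₀ and P₂ are even, which makes 2q divide U₀ and U₂ and thus 2a.
        q∣2a⇒⊥ : + q ∣ + 2 * a → ⊥
        q∣2a⇒⊥ q∣2a = q∤a (*-cancelˡ-∣ (+ 2) (∣-affine-difference a b (+ 0) (+ 2) 2q∣U₀ 2q∣U₂))
          where
          q∣U₂ : + q ∣ a * + 2 + b
          q∣U₂ = ∣-affine-forward a b (+ 0) (+ 2) q∣U₀ q∣2a
          q∤U₃ : ¬ + q ∣ a * + 3 + b
          q∤U₃ q∣U₃ = q∤a (∣-affine-difference a b (+ 2) (+ 1) q∣U₂ q∣U₃ ⟫ ℤ.*-identityˡ a)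
          q∣2P : ∀ x → Agrees q a b s c x → ¬ + q ∣ a * x + b → + q ∣ + 2 * (s * x + c)
          q∣2P x agreeₓ q∤U = [ ∣n⇒∣m*n (+ 2) , from-D ]′ (P-or-D x agreeₓ q∤U)
            where
            from-D : + q ∣ (a - s) * x + (b - c) → + q ∣ + 2 * (s * x + c)
            from-D q∣D = ∣m∣m-n⇒∣n (∣-affine-doubled a b (+ 0) q∣U₀ q∣U₂ x)
              (∣n⇒∣m*n (+ 2) q∣D ⟫ solve (a ∷ b ∷ s ∷ c ∷ x ∷ []))
          q∣4P : ∀ x → + q ∣ + 4 * (s * x + c)
          q∣4P x = ∣-affine-doubled (+ 2 * s) (+ 2 * c) (+ 1)
                     (q∣2P (+ 1) (window′ 1) q∤U₁ ⟫ solve (s ∷ c ∷ []))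
                     (q∣2P (+ 3) (window′ 3) q∤U₃ ⟫ solve (s ∷ c ∷ [])) x
                   ⟫ solve (s ∷ c ∷ x ∷ [])
          q∤P₂ : ¬ + q ∣ s * + 2 + c
          q∤P₂ q∣P₂ = [ P₁-then-P₂ , D₁-then-P₂ ]′ (P-or-D (+ 1) (window′ 1) q∤U₁)
            where
            P₁-then-P₂ : + q ∣ s * + 1 + c → ⊥
            P₁-then-P₂ q∣P₁ = q∤P₀ (∣-affine-consecutive s c (+ 1) q∣P₁ q∣P₂ (+ 0))
            D₁-then-P₂ : + q ∣ (a - s) * + 1 + (b - c) → ⊥
            D₁-then-P₂ q∣D₁ = q∤D₀ (∣-affine-consecutive (a - s) (b - c) (+ 1) q∣D₁
                                     (∣m∣n⇒∣m-n q∣U₂ q∣P₂ ⟫ affine-sub a b s c (+ 2)) (+ 0))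
          2q∣U₀ : + 2 * + q ∣ a * + 0 + b
          2q∣U₀ = 2q∣U (+ 0) (window′ 0) q∣U₀ q∤P₀ (∣4x⇒2∣x _ (q∣4P (+ 0)))
          2q∣U₂ : + 2 * + q ∣ a * + 2 + b
          2q∣U₂ = 2q∣U (+ 2) (window′ 2) q∣U₂ q∤P₂ (∣4x⇒2∣x _ (q∣4P (+ 2)))

        module _ (q∤2a : ¬ + q ∣ + 2 * a) where

          q∤U₂ : ¬ + q ∣ a * + 2 + b
          q∤U₂ q∣U₂ = q∤2a (∣-affine-difference a b (+ 0) (+ 2) q∣U₀ q∣U₂)

          q∤U₃ : ¬ + q ∣ a * + 3 + b
          q∤U₃ q∣U₃ = q∤a (∣3x⇒∣x a (∣-affine-difference a b (+ 0) (+ 3) q∣U₀ q∣U₃))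

          -- P₀ and P₄ are then even and not divisible by q, so 2q divides U₀ and U₄, hence 4a.
          q∣2c∧q∣4s∧q∣4[a-s]⇒⊥ : + q ∣ + 2 * c → + q ∣ + 4 * s → + q ∣ + 4 * (a - s) → ⊥
          q∣2c∧q∣4s∧q∣4[a-s]⇒⊥ q∣2c q∣4s q∣4[a-s] = q∤2a (*-cancelˡ-∣ (+ 2)
            (∣-affine-difference a b (+ 0) (+ 4) 2q∣U₀ 2q∣U₄ ⟫ solve (a ∷ [])))
            where
            q∣4a : + q ∣ + 4 * a
            q∣4a = ∣m∣n⇒∣m+n q∣4s q∣4[a-s] ⟫ solve (a ∷ s ∷ [])
            2∣P₀ : + 2 ∣ s * + 0 + c
            2∣P₀ = ∣2x⇒2∣x c q∣2c ⟫ solve (s ∷ c ∷ [])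
            2∣P₄ : + 2 ∣ s * + 4 + c
            2∣P₄ = ∣-affine-forward s c (+ 0) (+ 4) 2∣P₀ (∣m⇒∣m*n s (divides (+ 2) refl))
            q∤P₄ : ¬ + q ∣ s * + 4 + c
            q∤P₄ q∣P₄ = q∤P₀ (∣-affine-backward s c (+ 0) (+ 4) q∣P₄ q∣4s)
            2q∣U₀ : + 2 * + q ∣ a * + 0 + b
            2q∣U₀ = 2q∣U (+ 0) (window′ 0) q∣U₀ q∤P₀ 2∣P₀
            2q∣U₄ : + 2 * + q ∣ a * + 4 + b
            2q∣U₄ = 2q∣U (+ 4) (window′ 4) (∣-affine-forward a b (+ 0) (+ 4) q∣U₀ q∣4a)
                         q∤P₄ 2∣P₄

          -- Two consecutive zeros of P (or of D) would spread to 0, where neither vanishes.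
          interleaving⇒⊥ : P∣∨D∣ (+ 1) → P∣∨D∣ (+ 2) → P∣∨D∣ (+ 3) → ⊥
          interleaving⇒⊥ (inj₁ q∣P₁) (inj₁ q∣P₂) _ =
            q∤P₀ (∣-affine-consecutive s c (+ 1) q∣P₁ q∣P₂ (+ 0))
          interleaving⇒⊥ _ (inj₁ q∣P₂) (inj₁ q∣P₃) =
            q∤P₀ (∣-affine-consecutive s c (+ 2) q∣P₂ q∣P₃ (+ 0))
          interleaving⇒⊥ (inj₂ q∣D₁) (inj₂ q∣D₂) _ =
            q∤D₀ (∣-affine-consecutive (a - s) (b - c) (+ 1) q∣D₁ q∣D₂ (+ 0))
          interleaving⇒⊥ _ (inj₂ q∣D₂) (inj₂ q∣D₃) =
            q∤D₀ (∣-affine-consecutive (a - s) (b - c) (+ 2) q∣D₂ q∣D₃ (+ 0))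
          interleaving⇒⊥ (inj₁ q∣P₁) (inj₂ q∣D₂) (inj₁ q∣P₃) =
            let q∣2c , _ , q∣4s , q∣4[a-s] = ∣-affine-interleaved s c (a - s) (b - c)
                                               (q∣b ⟫ solve (b ∷ c ∷ [])) q∣P₁ q∣D₂ q∣P₃
            in q∣2c∧q∣4s∧q∣4[a-s]⇒⊥ q∣2c q∣4s q∣4[a-s]
          interleaving⇒⊥ (inj₂ q∣D₁) (inj₁ q∣P₂) (inj₂ q∣D₃) =
            let _ , q∣2c , q∣4[a-s] , q∣4s = ∣-affine-interleaved (a - s) (b - c) s c
                                               (q∣b ⟫ solve (b ∷ c ∷ [])) q∣D₁ q∣P₂ q∣D₃
            in q∣2c∧q∣4s∧q∣4[a-s]⇒⊥ q∣2c q∣4s q∣4[a-s]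

          q∤2a⇒⊥ : ⊥
          q∤2a⇒⊥ = interleaving⇒⊥ (P-or-D (+ 1) (window′ 1) q∤U₁)
                                  (P-or-D (+ 2) (window′ 2) q∤U₂)
                                  (P-or-D (+ 3) (window′ 3) q∤U₃)

        impossible : ⊥
        impossible = [ q∣2a⇒⊥ , q∤2a⇒⊥ ]′ (toSum (+ q ∣? + 2 * a))

    window-excludes-isolated-zero : ∀ a b s c → + q ∣ b → ¬ + q ∣ c → ¬ + q ∣ a →
                                    (∀ j → j ℕ.≤ 4 → Agrees q a b s c (+ j)) → ⊥
    window-excludes-isolated-zero = IsolatedZero.impossible

    module _ (a b s c : ℤ) (reduced : ¬ ((+ q ∣ a) × (+ q ∣ b)))
             (window : ∀ j → j ℕ.≤ 7 → Agrees q a b s c (+ j)) where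

      private
        q∤a : ∀ x → + q ∣ a * x + b → ¬ + q ∣ a
        q∤a x q∣U q∣a = reduced (q∣a , (∣m∣n⇒∣m-n q∣U (∣n⇒∣m*n x q∣a) ⟫ solve (a ∷ b ∷ x ∷ [])))

        q∤U-in-window : ∀ j → j ℕ.≤ 7 → ¬ + q ∣ s * + j + c → ¬ + q ∣ a * + j + b
        q∤U-in-window j j≤7 q∤P q∣U = [ upward , downward ]′ (toSum (j ℕ.≤? 3))
          where
          upward : j ℕ.≤ 3 → ⊥
          upward j≤3 = window-excludes-isolated-zero a (a * + j + b) s (s * + j + c)
            q∣U q∤P (q∤a (+ j) q∣U)
            (λ i i≤4 → Agrees-cong (cong (fq q) (affine-shift a b (+ j) (+ i)))
                                   (affine-shift s c (+ j) (+ i))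
                                   (window (j ℕ.+ i) (ℕ.+-mono-≤ j≤3 i≤4)))
          downward : ¬ j ℕ.≤ 3 → ⊥
          downward j≰3 = window-excludes-isolated-zero (- a) (a * + j + b) (- s) (s * + j + c)
            q∣U q∤P (λ q∣-a → q∤a (+ j) q∣U (∣m⇒∣-m q∣-a ⟫ ℤ.neg-involutive a))
            (λ i i≤4 → Agrees-cong (cong (fq q) (reflect a b i i≤4)) (reflect s c i i≤4)
                                   (window (j ℕ.∸ i) (ℕ.≤-trans (ℕ.m∸n≤m j i) j≤7)))
            where
            reflect : ∀ f g i → i ℕ.≤ 4 → f * + (j ℕ.∸ i) + g ≡ (- f) * + i + (f * + j + g)
            reflect f g i i≤4 = trans
              (cong (λ z → f * z + g) (sym (trans (ℤ.m-n≡m⊖n j i) (ℤ.⊖-≥ i≤j))))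
              (affine-reflect f g (+ j) (+ i))
              where i≤j = ℕ.≤-trans i≤4 (ℕ.≰⇒> j≰3)

        q∣D-in-window : ∀ j → j ℕ.≤ 4 → ¬ + q ∣ s * + j + c → + q ∣ (a - s) * + j + (b - c)
        q∣D-in-window j j≤4 q∤P =
          %ℕ-≡⇒∣ (a * + j + b) (s * + j + c)
            (trans (sym (fq-∤ _ (q∤U-in-window j j≤7 q∤P))) (agree (window j j≤7) q∤P))
          ⟫ affine-sub a b s c (+ j)
          where j≤7 = ℕ.≤-trans j≤4 (ℕ.m≤m+n 4 3)

        q∣D : ∀ x → ¬ + q ∣ s * x + c → + q ∣ (a - s) * x + (b - c)
        q∣D = affine-propagation (a - s) (b - c) s c q∣D-in-window

      reduced-agreement : ∀ x → Agrees q a b s c x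
      reduced-agreement x = agreeing λ q∤P →
        let q∤U : ¬ + q ∣ a * x + b
            q∤U q∣U = q∤P (∣m∣m-n⇒∣n q∣U (q∣D x q∤P ⟫ sym (affine-sub a b s c x)))
        in trans (fq-∤ _ q∤U)
                 (∣⇒%ℕ-≡ (a * x + b) (s * x + c) (q∣D x q∤P ⟫ sym (affine-sub a b s c x)))

    affine-agreement : ∀ a b s c x₀ → (∀ j → j ℕ.≤ 7 → Agrees q a b s c (x₀ + + j)) →
                       ∀ x → Agrees q a b s c x
    affine-agreement a b s c x₀ window x =
      let a′ , b′ , reduced , g≡g′ = reduced-form 1<q a (a * x₀ + b)
          window′ : ∀ j → j ℕ.≤ 7 → Agrees q a′ b′ s (s * x₀ + c) (+ j)
          window′ j j≤7 = Agrees-cong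
            (trans (cong (fq q) (affine-shift a b x₀ (+ j))) (g≡g′ (+ j)))
            (affine-shift s c x₀ (+ j)) (window j j≤7)
      in Agrees-cong (trans (sym (g≡g′ (x - x₀))) (cong (fq q) (unshift a b x₀ x)))
                     (unshift s c x₀ x)
                     (reduced-agreement a′ b′ s (s * x₀ + c) reduced window′ (x - x₀))
      where
      unshift : ∀ a b x₀ x → a * (x - x₀) + (a * x₀ + b) ≡ a * x + b
      unshift = solve-∀

  2^-coprime-3 : ∀ k → Coprime (2 ^ k) 3
  2^-coprime-3 zero = 1-coprimeTo 3
  2^-coprime-3 (suc k) {d} (d∣2^[1+k] , d∣3) =
    2^-coprime-3 k (coprime-divisor d⊥2 d∣2^[1+k] , d∣3)
    where
    d⊥2 : Coprime d 2
    d⊥2 (e∣d , e∣2) = ℕ.∣1⇒≡1 (ℕ.∣m+n∣m⇒∣n (ℕ.∣-trans e∣d d∣3) e∣2)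

  8∣2^ : ∀ {k} → 3 ℕ.≤ k → 8 ℕ.∣ 2 ^ k
  8∣2^ {k} 3≤k = ℕ.divides (2 ^ (k ℕ.∸ 3))
    (trans (cong (2 ^_) (sym (ℕ.m∸n+n≡m 3≤k))) (ℕ.^-distribˡ-+-* 2 (k ℕ.∸ 3) 3))

  module _ (s₀ : ℕ) where

    private instance
      2^s₀≢0 : NonZero (2 ^ s₀)
      2^s₀≢0 = pow2-nonzero s₀

    α≡%ℕ : ∀ s c n → α s₀ s c n ≡ (+ s * + n + + c) %ℕ (2 ^ s₀)
    α≡%ℕ s c n = cong (_%ℕ (2 ^ s₀))
      (trans (ℤ.pos-+ (s ℕ.* n) c) (cong (_+ + c) (ℤ.pos-* s n)))

    α-agreement⇒Agrees : ∀ {s c a b n} →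
                         (α s₀ s c n ≢ 0 → f s₀ (a * + n + b) ≡ α s₀ s c n) →
                         Agrees (2 ^ s₀) a b (+ s) (+ c) (+ n)
    α-agreement⇒Agrees {s} {c} {n = n} agreeₙ = agreeing λ q∤α →
      trans (agreeₙ (λ α≡0 → q∤α (%ℕ≡0⇒∣ _ (trans (sym (α≡%ℕ s c n)) α≡0)))) (α≡%ℕ s c n)

    Agrees⇒α-agreement : ∀ {s c a b n} → Agrees (2 ^ s₀) a b (+ s) (+ c) (+ n) →
                         α s₀ s c n ≢ 0 → f s₀ (a * + n + b) ≡ α s₀ s c n
    Agrees⇒α-agreement {s} {c} {n = n} agreeₙ α≢0 = trans
      (agree agreeₙ (λ q∣α → α≢0 (trans (α≡%ℕ s c n) (∣⇒%ℕ≡0 _ q∣α))))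
      (sym (α≡%ℕ s c n))

open import Defs
open import Data.Nat using (ℕ; _≤_; _+_; _*_; _^_)
open import Data.Integer using (ℤ; +_) renaming (_+_ to _+ℤ_; _*_ to _*ℤ_)
open import Data.Nat.Properties using (m≤m+n; +-monoʳ-≤)
open import Data.Product using (∃-syntax; _,_)
open import Relation.Binary.PropositionalEquality using (_≡_; _≢_)
open AffineAgreement
  using (affine-agreement; 8∣2^; 2^-coprime-3; α-agreement⇒Agrees; Agrees⇒α-agreement)

proposition8p2 : ∃[ s₁ ] ∀ (s₀ : ℕ) → s₁ ≤ s₀ →
    ∀ (n₀ : ℕ) → 1 ≤ n₀ → n₀ + 7 ≤ (2 ^ s₀) * (2 ^ s₀) →
    ∀ (s c : ℕ) (a b : ℤ) →
    (∀ (n : ℕ) → n₀ ≤ n → n ≤ n₀ + 7 → α s₀ s c n ≢ 0 →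
      f s₀ (a *ℤ (+ n) +ℤ b) ≡ α s₀ s c n) →
    ∀ (n : ℕ) → 1 ≤ n → n ≤ (2 ^ s₀) * (2 ^ s₀) → α s₀ s c n ≢ 0 →
      f s₀ (a *ℤ (+ n) +ℤ b) ≡ α s₀ s c n
proposition8p2 = 3 , λ s₀ 3≤s₀ n₀ _ _ s c a b agree-on-window n _ _ →
  Agrees⇒α-agreement s₀
    (affine-agreement ⦃ pow2-nonzero s₀ ⦄ (8∣2^ 3≤s₀) (2^-coprime-3 s₀) a b (+ s) (+ c) (+ n₀)
      (λ j j≤7 → α-agreement⇒Agrees s₀
        (agree-on-window (n₀ + j) (m≤m+n n₀ j) (+-monoʳ-≤ n₀ j≤7)))
      (+ n))
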